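{- Let $K=\mathbb{Q}(\sqrt{D})$ where $D\in\mathbb{Z}_{\ge2}$ is squarefree. For every $n\in\mathbb{Z}_{\ge0}$, \[ P_K(n)\equiv p_K(n)\pmod 2. \]
   Context: $\mathcal{O}_K$ is the ring of integers of $K$ and $\mathcal{O}_K^+$ is the set of totally positive elements of $\mathcal{O}_K$ (elements $\gamma$ with $\gamma>0$ and $\gamma'>0$, where $'$ denotes Galois conjugation). A partition of $\alpha\in\mathcal{O}_K^+$ is an expression $\alpha=\alpha_1+\dots+\alpha_k$ with $k\ge1$ and all $\alpha_i\in\mathcal{O}_K^+$, the order of the summands being irrelevant; $p_K(\alpha)$ is the number of partitions of $\alpha$, and $p_K(0)=1$. For $n\in\mathbb{Z}_{\ge1}$, $P_K(n)=\sum_{\alpha\in\mathcal{O}_K^+,\ \mathrm{Tr}\,\alpha=2n} p_K(\alpha)$, where $\mathrm{Tr}\,\alpha=\alpha+\alpha'$; and $P_K(0)=1$. -}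

module Defs where

open import Data.Nat as ℕ using (ℕ; zero; suc; _%_; _≡ᵇ_)
open import Data.Nat.Divisibility using (_∣_)
open import Data.Integer as ℤ using (ℤ; +_; 0ℤ)
open import Data.Bool using (if_then_else_)
open import Data.Product using (Σ; _×_; _,_)
open import Data.Sum using (_⊎_)
open import Data.Unit using (⊤)
open import Data.List using (List; []; _∷_; foldr)
open import Data.List.Relation.Unary.All using (All)
open import Data.List.Relation.Unary.Linked using (Linked)
open import Relation.Binary.PropositionalEquality using (_≡_)

SquareFree : ℕ → Set
SquareFree D = (p : ℕ) → p ℕ.* p ∣ D → p ≡ 1

-- An element of O_K, K = ℚ(√D), in the integral basis {1, ω}:
-- (a , b) stands for a + b ω, where ω = (1+√D)/2 if D ≡ 1 (mod 4)
-- and ω = √D otherwise (D squarefree, D ≥ 2).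
OK : Set
OK = ℤ × ℤ

-- twice-coordinates: (a , b) ↦ (x , y) with a + b ω = (x + y √D)/2
tw : ℕ → OK → ℤ × ℤ
tw D (a , b) =
  if D % 4 ≡ᵇ 1
  then (+ 2 ℤ.* a ℤ.+ b , b)
  else (+ 2 ℤ.* a , + 2 ℤ.* b)

Tr : ℕ → OK → ℤ
Tr D α with tw D α
... | (x , y) = x

-- α = (x + y√D)/2 is totally positive iff both (x ± y√D)/2 > 0,
-- i.e. x > 0 and x² > D y² (written out without reals).
TotPos : ℕ → OK → Set
TotPos D α with tw D α
... | (x , y) = (0ℤ ℤ.< x) × ((+ D) ℤ.* (y ℤ.* y) ℤ.< x ℤ.* x)

_+K_ : OK → OK → OK
(a , b) +K (c , d) = (a ℤ.+ c , b ℤ.+ d)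

0K : OK
0K = (0ℤ , 0ℤ)

sumK : List OK → OK
sumK = foldr _+K_ 0K

ι : ℕ → OK
ι n = (+ n , 0ℤ)

-- lexicographic total order on coordinates (used only to pick a canonical
-- ordering of the summands, i.e. to represent multisets)
_≼_ : OK → OK → Set
(a , b) ≼ (c , d) = (a ℤ.< c) ⊎ ((a ≡ c) × (b ℤ.≤ d))

-- Partitions of α: unordered multisets of totally positive summands
-- with sum α, represented as ≼-sorted lists. The empty list is the unique
-- partition of 0, giving p_K(0) = 1.
Partition : ℕ → OK → Set
Partition D α =
  Σ (List OK) λ l → All (TotPos D) l × Linked _≼_ l × sumK l ≡ α

PKSet : ℕ → ℕ → Set
PKSet D zero = ⊤
PKSet D (suc n) =
  Σ OK λ α → TotPos D α × Tr D α ≡ + (2 ℕ.* suc n) × Partition D α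

-- Galois conjugation σ acts on the pairs (α, partition of α) with Tr α = 2n counted by
-- P_K(n), conjugating α and every summand; it is an involution. The pairs with α = n are
-- exactly the partitions counted by p_K(n), and σ preserves this set. Outside it σ has no
-- fixed point, since σα = α forces α to be rational and hence α = Tr α / 2 = n. So the other
-- pairs fall into orbits of size two, and P_K(n) − p_K(n) is even.

module Submission where

open import Defs
open import Axiom.UniquenessOfIdentityProofs.WithK using (uip)
open import Data.Bool using (Bool; true; false; not; if_then_else_)
open import Data.Bool.Properties using (_≟_)
open import Data.Empty using (⊥-elim)
open import Data.Fin using (Fin; zero; suc)
open import Data.Fin.Properties using (+↔⊎; 1↔⊤; <-cmp; _<?_; <-asym)
open import Data.Fin.Permutation using (↔⇒≡)
open import Data.Integer as ℤ using (ℤ; +_; -[1+_]; 0ℤ; -_)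
import Data.Integer.Properties as ℤ
open import Data.Integer.Tactic.RingSolver using (solve-∀)
open import Data.List using (List; []; _∷_; map)
open import Data.List.Properties using (map-∘; map-cong; map-id)
open import Data.List.Relation.Binary.Permutation.Propositional as ↭ using (_↭_; ↭-sym; ↭⇒↭ₛ)
import Data.List.Relation.Binary.Permutation.Propositional.Properties as ↭
open import Data.List.Relation.Binary.Pointwise using (Pointwise-≡⇒≡)
import Data.List.Relation.Unary.All as All
import Data.List.Relation.Unary.All.Properties as All
open import Data.List.Relation.Unary.All using (All; []; _∷_)
import Data.List.Relation.Unary.Linked as Linked
open import Data.List.Relation.Unary.Linked using (Linked; [])
import Data.List.Relation.Unary.Sorted.TotalOrder.Properties as Sorted
open import Data.Nat as ℕ using (ℕ; zero; suc; _+_; _*_; _%_; _≡ᵇ_; _≤_)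
open import Data.Nat.Divisibility using (_∣_; divides)
open import Data.Nat.DivMod using (%-remove-+ʳ)
open import Data.Nat.Properties using (+-identityʳ; *-comm)
open import Data.Product using (Σ; ∃-syntax; _×_; _,_; proj₁; proj₂)
open import Data.Product.Properties using (≡-dec)
open import Data.Product.Relation.Binary.Lex.Strict using (×-transitive; ×-antisymmetric; ×-total₂; ×-decidable)
open import Data.Product.Relation.Binary.Pointwise.NonDependent using (≡×≡⇒≡)
open import Data.Sum using (_⊎_; inj₁; inj₂; [_,_])
open import Data.Sum.Function.Propositional using (_⊎-cong_)
open import Data.Unit using (⊤)
open import Function using (_∘_; id)
open import Function.Bundles using (_↔_; _⇔_; Inverse; Injection; mk↔ₛ′; mk⇔)
open import Function.Properties.Inverse using (↔-sym; ↔-trans; ↔⇒↣)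
open import Relation.Binary.Bundles using (DecTotalOrder)
open import Relation.Binary.Definitions using (Decidable; tri<; tri≈; tri>)
open import Relation.Binary.PropositionalEquality
  using (_≡_; refl; sym; trans; cong; cong₂; subst; isEquivalence; resp₂; module ≡-Reasoning)
open import Relation.Nullary using (¬_; yes; no; does; proof; contradiction)
open import Relation.Nullary.Reflects using (Reflects; invert)
open import Relation.Nullary.Decidable using (dec-true; dec-false; does-⇔)

private
  variable
    X : Set
    N : ℕ

Fiber : (X → Bool) → Bool → Set
Fiber {X} f b = Σ X λ x → f x ≡ b

fiber-≡ : {f : X → Bool} {b : Bool} {x y : X} → x ≡ y →
  (e : f x ≡ b) (e′ : f y ≡ b) → _≡_ {A = Fiber f b} (x , e) (y , e′)
fiber-≡ refl e e′ = cong (_ ,_) (uip e e′)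

↔-fibers : (f : X → Bool) → X ↔ (Fiber f true ⊎ Fiber f false)
↔-fibers f = mk↔ₛ′ (λ x → classify x (f x) refl) [ proj₁ , proj₁ ]
  (λ { (inj₁ (x , e)) → classify-true x (f x) refl e
     ; (inj₂ (x , e)) → classify-false x (f x) refl e })
  (λ x → classify-proj₁ x (f x) refl)
  where
  classify : ∀ x b → f x ≡ b → Fiber f true ⊎ Fiber f false
  classify x true  e = inj₁ (x , e)
  classify x false e = inj₂ (x , e)
  classify-true : ∀ x b (e₀ : f x ≡ b) (e : f x ≡ true) → classify x b e₀ ≡ inj₁ (x , e)
  classify-true x true  e₀ e = cong inj₁ (fiber-≡ refl e₀ e)
  classify-true x false e₀ e = contradiction (trans (sym e₀) e) λ ()
  classify-false : ∀ x b (e₀ : f x ≡ b) (e : f x ≡ false) → classify x b e₀ ≡ inj₂ (x , e)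
  classify-false x true  e₀ e = contradiction (trans (sym e₀) e) λ ()
  classify-false x false e₀ e = cong inj₂ (fiber-≡ refl e₀ e)
  classify-proj₁ : ∀ x b (e₀ : f x ≡ b) → [ proj₁ , proj₁ ] (classify x b e₀) ≡ x
  classify-proj₁ x true  e₀ = refl
  classify-proj₁ x false e₀ = refl

Fiber-suc↔ : (g : Fin (suc N) → Bool) (b : Bool) →
  Fiber g b ↔ ((g zero ≡ b) ⊎ Fiber (g ∘ suc) b)
Fiber-suc↔ g b = mk↔ₛ′ split join split∘join join∘split
  where
  split : Fiber g b → (g zero ≡ b) ⊎ Fiber (g ∘ suc) b
  split (zero  , e) = inj₁ e
  split (suc i , e) = inj₂ (i , e)
  join : (g zero ≡ b) ⊎ Fiber (g ∘ suc) b → Fiber g b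
  join (inj₁ e)       = zero , e
  join (inj₂ (i , e)) = suc i , e
  split∘join : ∀ y → split (join y) ≡ y
  split∘join (inj₁ _) = refl
  split∘join (inj₂ _) = refl
  join∘split : ∀ x → join (split x) ≡ x
  join∘split (zero  , _) = refl
  join∘split (suc _ , _) = refl

Fin-fiber-finite : (g : Fin N → Bool) (b : Bool) → ∃[ m ] (Fiber g b ↔ Fin m)
Fin-fiber-finite {zero} g b = 0 , mk↔ₛ′ (λ ()) (λ ()) (λ ()) (λ ())
Fin-fiber-finite {suc N} g b with Fin-fiber-finite (g ∘ suc) b | g zero ≟ b
... | m , rest | yes e = suc m ,
  ↔-trans (Fiber-suc↔ g b) (↔-trans (point ⊎-cong rest) (↔-sym +↔⊎))
  where
  point : (g zero ≡ b) ↔ Fin 1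
  point = mk↔ₛ′ (λ _ → zero) (λ _ → e) (λ { zero → refl }) (uip e)
... | m , rest | no ¬e = m ,
  ↔-trans (Fiber-suc↔ g b) (↔-trans (none ⊎-cong rest) (↔-sym (+↔⊎ {0})))
  where
  none : (g zero ≡ b) ↔ Fin 0
  none = mk↔ₛ′ (⊥-elim ∘ ¬e) (λ ()) (λ ()) (⊥-elim ∘ ¬e)

Fiber-↔∘from : (h : X ↔ Fin N) (f : X → Bool) (b : Bool) →
  Fiber f b ↔ Fiber (f ∘ Inverse.from h) b
Fiber-↔∘from h f b = mk↔ₛ′ forth back forth∘back back∘forth
  where
  open Inverse h
  forth : Fiber f b → Fiber (f ∘ from) b
  forth (x , e) = to x , trans (cong f (strictlyInverseʳ x)) e
  back : Fiber (f ∘ from) b → Fiber f b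
  back (i , e) = from i , e
  forth∘back : ∀ y → forth (back y) ≡ y
  forth∘back (i , e) = fiber-≡ (strictlyInverseˡ i) _ e
  back∘forth : ∀ x → back (forth x) ≡ x
  back∘forth (x , e) = fiber-≡ (strictlyInverseʳ x) _ e

fiber-finite : X ↔ Fin N → (f : X → Bool) (b : Bool) → ∃[ m ] (Fiber f b ↔ Fin m)
fiber-finite h f b with Fin-fiber-finite (f ∘ Inverse.from h) b
... | m , fin = m , ↔-trans (Fiber-↔∘from h f b) fin

size-⊎ : {A B : Set} {a b : ℕ} → X ↔ Fin N → X ↔ (A ⊎ B) → A ↔ Fin a → B ↔ Fin b → N ≡ a + b
size-⊎ X↔N X↔A⊎B A↔a B↔b =
  ↔⇒≡ (↔-trans (↔-sym X↔N) (↔-trans X↔A⊎B (↔-trans (A↔a ⊎-cong B↔b) (↔-sym +↔⊎))))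

module _ (h : X ↔ Fin N) (τ : X → X) (τ-involutive : ∀ x → τ (τ x) ≡ x)
         (τ-fixed-point-free : ∀ x → ¬ τ x ≡ x) where
  open Inverse h

  -- Comparing positions under h singles out one element of each orbit {x , τ x}.
  ascends : X → Bool
  ascends x = does (to x <? to (τ x))

  ascends-τ : ∀ x → ascends (τ x) ≡ not (ascends x)
  ascends-τ x rewrite τ-involutive x with <-cmp (to x) (to (τ x))
  ... | tri< x<τx _ _ = trans (dec-false (to (τ x) <? to x) (<-asym x<τx))
                             (cong not (sym (dec-true (to x <? to (τ x)) x<τx)))
  ... | tri≈ _ x≈τx _ = contradiction (sym (Injection.injective (↔⇒↣ h) x≈τx)) (τ-fixed-point-free x)
  ... | tri> _ _ τx<x = trans (dec-true (to (τ x) <? to x) τx<x)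
                             (cong not (sym (dec-false (to x <? to (τ x)) (<-asym τx<x))))

  τ-swaps-fibers : Fiber ascends true ↔ Fiber ascends false
  τ-swaps-fibers = mk↔ₛ′ swap swap
    (λ (x , e) → fiber-≡ (τ-involutive x) _ e) (λ (x , e) → fiber-≡ (τ-involutive x) _ e)
    where
    swap : ∀ {b} → Fiber ascends b → Fiber ascends (not b)
    swap (x , e) = τ x , trans (ascends-τ x) (cong not e)

  fixed-point-free-involution⇒even : 2 ∣ N
  fixed-point-free-involution⇒even with fiber-finite h ascends true
  ... | m , fin = divides m
    (trans (size-⊎ h (↔-fibers ascends) fin (↔-trans (↔-sym τ-swaps-fibers) fin)) (m+m≡m*2 m))
    where
    m+m≡m*2 : ∀ m → m + m ≡ m * 2
    m+m≡m*2 m = trans (cong (λ k → m + k) (sym (+-identityʳ m))) (*-comm 2 m)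

involution-parity : {p : ℕ} (h : X ↔ Fin N) (f : X → Bool) (τ : X → X) →
  (∀ x → τ (τ x) ≡ x) → (∀ x → f (τ x) ≡ f x) → (∀ x → τ x ≡ x → f x ≡ true) →
  Fiber f true ↔ Fin p → N % 2 ≡ p % 2
involution-parity {N = N} {p = p} h f τ τ-involutive f-τ fixed⇒true fin-true
  with fiber-finite h f false
... | m , fin-false = begin
  N % 2       ≡⟨ cong (_% 2) (size-⊎ h (↔-fibers f) fin-true fin-false) ⟩
  (p + m) % 2 ≡⟨ %-remove-+ʳ p
                   (fixed-point-free-involution⇒even fin-false τ′ τ′-involutive τ′-fixed-point-free) ⟩
  p % 2       ∎
  where
  open ≡-Reasoning
  τ′ : Fiber f false → Fiber f false
  τ′ (x , e) = τ x , trans (f-τ x) e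
  τ′-involutive : ∀ y → τ′ (τ′ y) ≡ y
  τ′-involutive (x , e) = fiber-≡ (τ-involutive x) _ e
  τ′-fixed-point-free : ∀ y → ¬ τ′ y ≡ y
  τ′-fixed-point-free (x , e) τ′y≡y with () ← trans (sym e) (fixed⇒true x (cong proj₁ τ′y≡y))

_≟K_ : Decidable {A = OK} _≡_
_≟K_ = ≡-dec ℤ._≟_ ℤ._≟_

≼-decTotalOrder : DecTotalOrder _ _ _
≼-decTotalOrder = record
  { Carrier = OK
  ; _≈_ = _≡_
  ; _≤_ = _≼_
  ; isDecTotalOrder = record
    { isTotalOrder = record
      { isPartialOrder = record
        { isPreorder = record
          { isEquivalence = isEquivalence
          ; reflexive = λ { refl → inj₂ (refl , ℤ.≤-refl) }
          ; trans = ×-transitive {_<₂_ = ℤ._≤_} isEquivalence (resp₂ ℤ._<_) ℤ.<-trans ℤ.≤-trans }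
        ; antisym = λ x≼y y≼x → ≡×≡⇒≡ (×-antisymmetric {_<₁_ = ℤ._<_} {_≈₂_ = _≡_} {_<₂_ = ℤ._≤_}
                                        sym ℤ.<-irrefl ℤ.<-asym ℤ.≤-antisym x≼y y≼x) }
      ; total = ×-total₂ sym ℤ.<-cmp ℤ.≤-total }
    ; _≟_ = _≟K_
    ; _≤?_ = ×-decidable ℤ._≟_ ℤ._<?_ ℤ._≤?_ } }

open import Data.List.Sort.InsertionSort.Base ≼-decTotalOrder using (sort)
open import Data.List.Sort.InsertionSort.Properties ≼-decTotalOrder using (sort-↭; sort-↗)

≼-irrelevant : ∀ {x y} (p q : x ≼ y) → p ≡ q
≼-irrelevant (inj₁ p)       (inj₁ q)       = cong inj₁ (ℤ.<-irrelevant p q)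
≼-irrelevant (inj₁ p)       (inj₂ (e , _)) = contradiction p (ℤ.<-irrefl e)
≼-irrelevant (inj₂ (e , _)) (inj₁ q)       = contradiction q (ℤ.<-irrefl e)
≼-irrelevant (inj₂ (e , p)) (inj₂ (e′ , q)) = cong inj₂ (cong₂ _,_ (uip e e′) (ℤ.≤-irrelevant p q))

sorted-↭⇒≡ : ∀ {xs ys} → Linked _≼_ xs → Linked _≼_ ys → xs ↭ ys → xs ≡ ys
sorted-↭⇒≡ xs↗ ys↗ xs↭ys =
  Pointwise-≡⇒≡ (Sorted.↗↭↗⇒≋ (DecTotalOrder.totalOrder ≼-decTotalOrder) xs↗ ys↗ (↭⇒↭ₛ xs↭ys))

+K-comm : ∀ x y → x +K y ≡ y +K x
+K-comm (a , b) (c , d) = cong₂ _,_ (ℤ.+-comm a c) (ℤ.+-comm b d)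

+K-assoc : ∀ x y z → (x +K y) +K z ≡ x +K (y +K z)
+K-assoc (a , b) (c , d) (e , f) = cong₂ _,_ (ℤ.+-assoc a c e) (ℤ.+-assoc b d f)

sumK-↭ : ∀ {xs ys} → xs ↭ ys → sumK xs ≡ sumK ys
sumK-↭ ↭.refl = refl
sumK-↭ (↭.prep x p) = cong (x +K_) (sumK-↭ p)
sumK-↭ (↭.swap {xs} {ys} x y p) = begin
  x +K (y +K sumK xs)  ≡⟨ sym (+K-assoc x y (sumK xs)) ⟩
  (x +K y) +K sumK xs  ≡⟨ cong₂ _+K_ (+K-comm x y) (sumK-↭ p) ⟩
  (y +K x) +K sumK ys  ≡⟨ +K-assoc y x (sumK ys) ⟩
  y +K (x +K sumK ys)  ∎
  where open ≡-Reasoning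
sumK-↭ (↭.trans p q) = trans (sumK-↭ p) (sumK-↭ q)

-- The Bool c records the integral basis: c = true when ω = (1+√D)/2 (so ω' = 1 - ω),
-- c = false when ω = √D (so ω' = -ω). Thus tw D is coords (D % 4 ≡ᵇ 1).
coords : Bool → OK → ℤ × ℤ
coords c (a , b) = if c then (+ 2 ℤ.* a ℤ.+ b , b) else (+ 2 ℤ.* a , + 2 ℤ.* b)

conj : Bool → OK → OK
conj c (a , b) = (if c then a ℤ.+ b else a) , - b

conj-involutive : ∀ c α → conj c (conj c α) ≡ α
conj-involutive true  (a , b) = cong₂ _,_ (a+b-b≡a a b) (ℤ.neg-involutive b)
  where
  a+b-b≡a : ∀ a b → a ℤ.+ b ℤ.+ - b ≡ a
  a+b-b≡a = solve-∀
conj-involutive false (a , b) = cong (a ,_) (ℤ.neg-involutive b)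

conj-+K : ∀ c α β → conj c (α +K β) ≡ conj c α +K conj c β
conj-+K true  (a , b) (c , d) = cong₂ _,_ (interchange a b c d) (ℤ.neg-distrib-+ b d)
  where
  interchange : ∀ a b c d → a ℤ.+ c ℤ.+ (b ℤ.+ d) ≡ a ℤ.+ b ℤ.+ (c ℤ.+ d)
  interchange = solve-∀
conj-+K false (a , b) (c , d) = cong (a ℤ.+ c ,_) (ℤ.neg-distrib-+ b d)

conj-sumK : ∀ c l → sumK (map (conj c) l) ≡ conj c (sumK l)
conj-sumK true  []      = refl
conj-sumK false []      = refl
conj-sumK c     (x ∷ l) = trans (cong (conj c x +K_) (conj-sumK c l)) (sym (conj-+K c x (sumK l)))

conj-ι : ∀ c n → conj c (ι n) ≡ ι n
conj-ι true  n = cong (_, 0ℤ) (ℤ.+-identityʳ (+ n))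
conj-ι false n = refl

conj-≡ι⇔ : ∀ c α n → conj c α ≡ ι n ⇔ α ≡ ι n
conj-≡ι⇔ c α n = mk⇔
  (λ conj-α≡ι → trans (sym (conj-involutive c α)) (trans (cong (conj c) conj-α≡ι) (conj-ι c n)))
  (λ { refl → conj-ι c n })

coords-conj : ∀ c α → coords c (conj c α) ≡ (proj₁ (coords c α) , - proj₂ (coords c α))
coords-conj true  (a , b) = cong (_, - b) (2[a+b]-b≡2a+b a b)
  where
  2[a+b]-b≡2a+b : ∀ a b → + 2 ℤ.* (a ℤ.+ b) ℤ.+ - b ≡ + 2 ℤ.* a ℤ.+ b
  2[a+b]-b≡2a+b = solve-∀
coords-conj false (a , b) = cong (+ 2 ℤ.* a ,_) (sym (ℤ.neg-distribʳ-* (+ 2) b))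

trace-+K : ∀ c α β → proj₁ (coords c (α +K β)) ≡ proj₁ (coords c α) ℤ.+ proj₁ (coords c β)
trace-+K true  (a , b) (c , d) = distrib a b c d
  where
  distrib : ∀ a b c d → + 2 ℤ.* (a ℤ.+ c) ℤ.+ (b ℤ.+ d) ≡ + 2 ℤ.* a ℤ.+ b ℤ.+ (+ 2 ℤ.* c ℤ.+ d)
  distrib = solve-∀
trace-+K false (a , b) (c , d) = ℤ.*-distribˡ-+ (+ 2) a c

coords-rational : ∀ c a → coords c (a , 0ℤ) ≡ (+ 2 ℤ.* a , 0ℤ)
coords-rational true  a = cong (_, 0ℤ) (ℤ.+-identityʳ _)
coords-rational false a = cong (+ 2 ℤ.* a ,_) (ℤ.*-zeroʳ (+ 2))

coords-ι : ∀ c n → coords c (ι n) ≡ (+ (2 ℕ.* n) , 0ℤ)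
coords-ι c n = trans (coords-rational c (+ n)) (cong (_, 0ℤ) (sym (ℤ.pos-* 2 n)))

-b≡b⇒b≡0 : ∀ b → - b ≡ b → b ≡ 0ℤ
-b≡b⇒b≡0 (+ zero)  _  = refl
-b≡b⇒b≡0 (+ suc _) ()
-b≡b⇒b≡0 -[1+ _ ]  ()

conj-fixed⇒ι : ∀ c α n → conj c α ≡ α → proj₁ (coords c α) ≡ + (2 ℕ.* n) → α ≡ ι n
conj-fixed⇒ι c (a , b) n conj-α≡α tr with refl ← -b≡b⇒b≡0 b (cong proj₂ conj-α≡α) =
  cong (_, 0ℤ) (ℤ.*-cancelˡ-≡ (+ 2) a (+ n)
    (trans (sym (cong proj₁ (coords-rational c a))) (trans tr (ℤ.pos-* 2 n))))

σ : ℕ → OK → OK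
σ D = conj (D % 4 ≡ᵇ 1)

-- TotPos D α unfolds to Positive D (tw D α).
Positive : ℕ → ℤ × ℤ → Set
Positive D (x , y) = (0ℤ ℤ.< x) × (+ D ℤ.* (y ℤ.* y) ℤ.< x ℤ.* x)

Tr-σ : ∀ D α → Tr D (σ D α) ≡ Tr D α
Tr-σ D α = cong proj₁ (coords-conj (D % 4 ≡ᵇ 1) α)

TotPos-σ : ∀ D α → TotPos D α → TotPos D (σ D α)
TotPos-σ D α = subst (Positive D) (sym (coords-conj (D % 4 ≡ᵇ 1) α)) ∘ Positive-neg (tw D α)
  where
  y²≡[-y]² : ∀ y → y ℤ.* y ≡ - y ℤ.* - y
  y²≡[-y]² = solve-∀
  Positive-neg : ∀ t → Positive D t → Positive D (proj₁ t , - proj₂ t)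
  Positive-neg (x , y) (x>0 , Dy²<x²) = x>0 , subst (λ z → + D ℤ.* z ℤ.< x ℤ.* x) (y²≡[-y]² y) Dy²<x²

TotPos-irrelevant : ∀ D α (p q : TotPos D α) → p ≡ q
TotPos-irrelevant D α (p , q) (p′ , q′) = cong₂ _,_ (ℤ.<-irrelevant p p′) (ℤ.<-irrelevant q q′)

Tr-ι : ∀ D n → Tr D (ι n) ≡ + (2 ℕ.* n)
Tr-ι D n = cong proj₁ (coords-ι (D % 4 ≡ᵇ 1) n)

TotPos-ι : ∀ D m → TotPos D (ι (suc m))
TotPos-ι D m = subst (Positive D) (sym (coords-ι (D % 4 ≡ᵇ 1) (suc m)))
  (ℤ.+<+ (ℕ.s≤s ℕ.z≤n) , subst (ℤ._< _) (sym (ℤ.*-zeroʳ (+ D))) (ℤ.+<+ (ℕ.s≤s ℕ.z≤n)))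

Tr-sumK-nonneg : ∀ D l → All (TotPos D) l → 0ℤ ℤ.≤ Tr D (sumK l)
Tr-sumK-pos : ∀ D x l → All (TotPos D) (x ∷ l) → 0ℤ ℤ.< Tr D (sumK (x ∷ l))

Tr-sumK-nonneg D []      []  = ℤ.≤-reflexive (sym (cong proj₁ (coords-ι (D % 4 ≡ᵇ 1) 0)))
Tr-sumK-nonneg D (x ∷ l) tps = ℤ.<⇒≤ (Tr-sumK-pos D x l tps)

Tr-sumK-pos D x l (tp ∷ tps) = subst (0ℤ ℤ.<_) (sym (trace-+K (D % 4 ≡ᵇ 1) x (sumK l)))
  (ℤ.+-mono-<-≤ (proj₁ tp) (Tr-sumK-nonneg D l tps))

partitions-of-0 : ∀ D → Partition D (ι 0) ↔ ⊤
partitions-of-0 D = mk↔ₛ′ _ (λ _ → [] , [] , [] , refl) (λ _ → refl) empty-only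
  where
  empty-only : ∀ π → ([] , [] , [] , refl) ≡ π
  empty-only ([]    , [] , [] , s) = cong (λ s → [] , [] , [] , s) (uip refl s)
  empty-only (x ∷ l , tps , _ , s) = contradiction
    (sym (trans (cong (Tr D) s) (cong proj₁ (coords-ι (D % 4 ≡ᵇ 1) 0)))) (ℤ.<⇒≢ (Tr-sumK-pos D x l tps))

σ-summands : ℕ → List OK → List OK
σ-summands D l = sort (map (σ D) l)

σ-summands-involutive : ∀ D l → Linked _≼_ l → σ-summands D (σ-summands D l) ≡ l
σ-summands-involutive D l l↗ = sorted-↭⇒≡ (sort-↗ (map (σ D) l′)) l↗ (begin
  sort (map (σ D) l′)     ↭⟨ sort-↭ (map (σ D) l′) ⟩
  map (σ D) l′            ↭⟨ ↭.map⁺ (σ D) (sort-↭ (map (σ D) l)) ⟩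
  map (σ D) (map (σ D) l) ≡⟨ map-∘ l ⟨
  map (σ D ∘ σ D) l       ≡⟨ map-cong (conj-involutive (D % 4 ≡ᵇ 1)) l ⟩
  map id l                ≡⟨ map-id l ⟩
  l                       ∎)
  where
  open ↭.PermutationReasoning
  l′ : List OK
  l′ = σ-summands D l

σ-partition : ∀ D α → Partition D α → Partition D (σ D α)
σ-partition D α (l , tps , _ , sum≡α) =
  σ-summands D l ,
  ↭.All-resp-↭ (↭-sym σl↭) (All.map⁺ (All.map (TotPos-σ D _) tps)) ,
  sort-↗ (map (σ D) l) ,
  trans (sumK-↭ σl↭) (trans (conj-sumK (D % 4 ≡ᵇ 1) l) (cong (σ D) sum≡α))
  where
  σl↭ : σ-summands D l ↭ map (σ D) l
  σl↭ = sort-↭ (map (σ D) l)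

PartitionOfTrace : ℕ → ℤ → Set
PartitionOfTrace D t = Σ OK λ α → TotPos D α × Tr D α ≡ t × Partition D α

module _ (D : ℕ) (t : ℤ) where

  summands : PartitionOfTrace D t → List OK
  summands (_ , _ , _ , l , _) = l

  PartitionOfTrace-≡ : (x y : PartitionOfTrace D t) →
    proj₁ x ≡ proj₁ y → summands x ≡ summands y → x ≡ y
  PartitionOfTrace-≡ (α , tp , tr , l , tps , l↗ , s) (.α , tp′ , tr′ , .l , tps′ , l↗′ , s′) refl refl
    rewrite TotPos-irrelevant D α tp tp′ | uip tr tr′ | uip s s′
          | All.irrelevant (TotPos-irrelevant D _) tps tps′ | Linked.irrelevant ≼-irrelevant l↗ l↗′ = refl

  σ-PartitionOfTrace : PartitionOfTrace D t → PartitionOfTrace D t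
  σ-PartitionOfTrace (α , tp , tr , π) = σ D α , TotPos-σ D α tp , trans (Tr-σ D α) tr , σ-partition D α π

  σ-PartitionOfTrace-involutive : ∀ x → σ-PartitionOfTrace (σ-PartitionOfTrace x) ≡ x
  σ-PartitionOfTrace-involutive x@(α , _ , _ , l , _ , l↗ , _) =
    PartitionOfTrace-≡ _ x (conj-involutive (D % 4 ≡ᵇ 1) α) (σ-summands-involutive D l l↗)

module _ (D m : ℕ) where
  private
    n : ℕ
    n = suc m

  is-ι : PartitionOfTrace D (+ (2 * n)) → Bool
  is-ι x = does (proj₁ x ≟K ι n)

  is-ι-σ : ∀ x → is-ι (σ-PartitionOfTrace D _ x) ≡ is-ι x
  is-ι-σ (α , _) = does-⇔ (conj-≡ι⇔ (D % 4 ≡ᵇ 1) α n) (σ D α ≟K ι n) (α ≟K ι n)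

  σ-fixed⇒is-ι : ∀ x → σ-PartitionOfTrace D _ x ≡ x → is-ι x ≡ true
  σ-fixed⇒is-ι (α , _ , tr , _) σx≡x =
    dec-true (α ≟K ι n) (conj-fixed⇒ι (D % 4 ≡ᵇ 1) α n (cong proj₁ σx≡x) tr)

  Fiber-is-ι↔partitions : Fiber is-ι true ↔ Partition D (ι n)
  Fiber-is-ι↔partitions = mk↔ₛ′ forget attach forget∘attach attach∘forget
    where
    is-ι⇒≡ : ∀ x → is-ι x ≡ true → proj₁ x ≡ ι n
    is-ι⇒≡ x e = invert (subst (Reflects _) e (proof (proj₁ x ≟K ι n)))
    forget : Fiber is-ι true → Partition D (ι n)
    forget (x@(_ , _ , _ , l , tps , l↗ , s) , e) = l , tps , l↗ , trans s (is-ι⇒≡ x e)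
    attach : Partition D (ι n) → Fiber is-ι true
    attach π = (ι n , TotPos-ι D m , Tr-ι D n , π) , dec-true (ι n ≟K ι n) refl
    forget∘attach : ∀ π → forget (attach π) ≡ π
    forget∘attach (l , tps , l↗ , s) = cong (λ s → l , tps , l↗ , s) (uip _ s)
    attach∘forget : ∀ y → attach (forget y) ≡ y
    attach∘forget (x , e) = fiber-≡ (PartitionOfTrace-≡ D _ _ x (sym (is-ι⇒≡ x e)) refl) _ e

lemma4p1 : (D : ℕ) → 2 ≤ D → SquareFree D → (n : ℕ) →
    (P p : ℕ) → PKSet D n ↔ Fin P → Partition D (ι n) ↔ Fin p →
    P % 2 ≡ p % 2
lemma4p1 D _ _ zero P p hP hp = cong (_% 2) (trans (≡1 hP) (sym (≡1 (↔-trans (↔-sym (partitions-of-0 D)) hp))))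
  where
  ≡1 : ∀ {k} → ⊤ ↔ Fin k → k ≡ 1
  ≡1 h = ↔⇒≡ (↔-trans (↔-sym h) (↔-sym 1↔⊤))
lemma4p1 D _ _ (suc m) P p hP hp =
  involution-parity hP (is-ι D m) (σ-PartitionOfTrace D _) (σ-PartitionOfTrace-involutive D _)
    (is-ι-σ D m) (σ-fixed⇒is-ι D m) (↔-trans (Fiber-is-ι↔partitions D m) hp)
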